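{- Let $F$ be a global field, $n\ge 3$, $G=\mathrm{GL}_n$, and $1\le k\le n-2$. Then for all $w\in W_{I_{n-1}}$ and $w'\in W_{I_k}$, $$C(w)\,C(w_{n-1}w_{n-2}\cdots w_1)\,C(w^{ -1})\ \cap\ C(w')=\emptyset .$$
   Context: $B$ is the subgroup of invertible upper triangular matrices; the Weyl group $W$ is identified with the group of $n\times n$ permutation matrices; $w_i$ ($1\le i\le n-1$) is the permutation matrix of the transposition $(i,i+1)$. For $1\le k\le n-1$, $W_{I_k}$ is the subgroup of $W$ generated by $\{w_j: 1\le j\le n-1,\ j\ne k\}$. For $w\in W$, $C(w)=B(F)wB(F)$ is the Bruhat cell, and a product of subsets $XYZ$ means $\{xyz: x\in X,y\in Y,z\in Z\}$. -}

module Defs where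

open import Level using (Level; _⊔_; suc)
open import Algebra.Bundles using (CommutativeRing)
open import Data.Nat as ℕ using (ℕ; zero; _∸_; _≡ᵇ_; _≤_)
import Data.Nat
open import Data.Fin using (Fin; toℕ)
import Data.Fin as Fin
open import Data.Bool using (if_then_else_)
open import Data.List using (List; []; _∷_; foldr; reverse; map; downFrom)
open import Data.List.Relation.Unary.All using (All)
open import Data.Product using (Σ; ∃; ∃-syntax; _×_; _,_)
open import Relation.Nullary using (¬_)
open import Relation.Binary.PropositionalEquality using (_≡_; _≢_)

record Field (c ℓ : Level) : Set (Level.suc (c ⊔ ℓ)) where
  field
    commutativeRing : CommutativeRing c ℓ
  open CommutativeRing commutativeRing public
  field
    0≉1     : ¬ (0# ≈ 1#)
    inverse : ∀ x → ¬ (x ≈ 0#) → ∃[ y ] (x * y ≈ 1#)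

module Matrices {c ℓ : Level} (F : Field c ℓ) (n : ℕ) where
  open Field F

  -- n × n matrices over F, indexed by Fin n (0-based rows / columns)
  Mat : Set c
  Mat = Fin n → Fin n → Carrier

  infix 4 _≈ᴹ_
  infixl 7 _⊗_
  _≈ᴹ_ : Mat → Mat → Set ℓ
  A ≈ᴹ B = ∀ i j → A i j ≈ B i j

  ΣF : ∀ {m} → (Fin m → Carrier) → Carrier
  ΣF {zero}        f = 0#
  ΣF {Data.Nat.suc m} f = f Fin.zero + ΣF (λ i → f (Fin.suc i))

  _⊗_ : Mat → Mat → Mat
  (A ⊗ B) i j = ΣF (λ l → A i l * B l j)

  I : Mat
  I i j = if toℕ i ≡ᵇ toℕ j then 1# else 0#

  Invertible : Mat → Set (c ⊔ ℓ)
  Invertible A = ∃[ A' ] ((A ⊗ A' ≈ᴹ I) × (A' ⊗ A ≈ᴹ I))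

  UpperTriangular : Mat → Set ℓ
  UpperTriangular A = ∀ i j → toℕ j Data.Nat.< toℕ i → A i j ≈ 0#

  InB : Mat → Set (c ⊔ ℓ)
  InB A = UpperTriangular A × Invertible A

  InCell : Mat → Mat → Set (c ⊔ ℓ)
  InCell w M = ∃[ b₁ ] ∃[ b₂ ] (InB b₁ × InB b₂ × (M ≈ᴹ ((b₁ ⊗ w) ⊗ b₂)))

  InCell³ : Mat → Mat → Mat → Mat → Set (c ⊔ ℓ)
  InCell³ u v x M = ∃[ p ] ∃[ q ] ∃[ r ]
    (InCell u p × InCell v q × InCell x r × (M ≈ᴹ ((p ⊗ q) ⊗ r)))

  -- transposition (j-1, j) on 0-based indices, i.e. (j, j+1) 1-based
  τ : ℕ → ℕ → ℕ
  τ j a = if a ≡ᵇ (j ∸ 1) then j else (if a ≡ᵇ j then j ∸ 1 else a)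

  wgen : ℕ → Mat
  wgen j a b = if toℕ a ≡ᵇ τ j (toℕ b) then 1# else 0#

  word : List ℕ → Mat
  word = foldr (λ j M → wgen j ⊗ M) I

  -- a word in the generators of W_{I_k}: all letters j with 1 ≤ j ≤ n-1, j ≠ k
  WordIn : ℕ → List ℕ → Set
  WordIn k = All (λ j → (1 ≤ j) × (j ≤ n ∸ 1) × (j ≢ k))

  -- inverse of a word (each generator is an involution)
  inv : List ℕ → List ℕ
  inv = reverse

  cox : List ℕ
  cox = map Data.Nat.suc (downFrom (n ∸ 1))

module Submission where

-- Write n = m + 1 and index rows/columns by 0, …, m, with
-- `last` = m.  Let P_k be the set of matrices A with A i j ≈ 0 whenever
-- j < k ≤ i (the parabolic subgroup stabilising span(e₀, …, e_{k-1})).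
-- Upper triangular matrices and every generator w_j with j ≠ k lie in P_k,
-- so the cell C(w') is contained in P_k for w' ∈ W_{I_k}.
-- Suppose M ∈ C(w) C(c) C(w⁻¹) ∩ P_k, where c = w_{n-1} ⋯ w_1.  Cancelling
-- the two outer Borel factors (the inverse of an invertible upper triangular
-- matrix is upper triangular) gives Z = w Y w⁻¹ ∈ P_k with Y = β c β′, β and
-- β′ upper triangular with invertible diagonal.  Then Z i l = Y (σ i) (σ l)
-- for the row permutation σ of w, and σ fixes `last` since w ∈ W_{I_{n-1}}.
-- As c moves row 0 to the bottom and shifts the other rows up, Y has the
-- property: if Y last s ≈ 0 then s = p + 1 and Y p s ≉ 0.  Combined with
-- Z ∈ P_k this turns every column l < k into another column l′ < k with
-- σ l′ < σ l, an infinite descent in ℕ.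

open import Defs
open import Level using (Level; _⊔_)
open import Data.Nat using (ℕ; zero; suc; _≤_; _<_; _∸_; _≡ᵇ_; z≤n; s≤s; _≟_; _<?_)
import Data.Nat.Properties as ℕₚ
open import Data.Nat.Induction using (<-wellFounded)
open import Data.Fin using (Fin; toℕ; fromℕ; fromℕ<; inject₁; punchIn)
import Data.Fin as Fin
import Data.Fin.Properties as Finₚ
open import Data.Bool using (true; false; if_then_else_)
open import Data.List using (List; []; _∷_; _∷ʳ_; reverse; map; downFrom)
import Data.List.Properties as Listₚ
open import Data.List.Relation.Unary.All as All using (All; []; _∷_)
open import Data.Product using (∃-syntax; Σ-syntax; _×_; _,_; proj₁; proj₂)
open import Data.Sum using (_⊎_; inj₁; inj₂)
open import Data.Empty using (⊥; ⊥-elim)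
open import Relation.Nullary using (¬_; yes; no; contradiction)
open import Relation.Binary.Definitions using (tri<; tri≈; tri>)
open import Relation.Binary.PropositionalEquality as ≡ using (_≡_; _≢_)
open import Relation.Binary.Structures using (IsEquivalence)
import Relation.Binary.Construct.On as On
open import Induction.InfiniteDescent using (descent∧wf⇒empty)
open import Algebra.Bundles using (Monoid)
import Algebra.Properties.CommutativeSemigroup as CommutativeSemigroupProperties
import Algebra.Properties.Semiring.Sum as SemiringSum
import Algebra.Solver.Monoid as MonoidSolver
import Relation.Binary.Reasoning.Setoid as SetoidReasoning

if-≡ᵇ-yes : ∀ {a} {A : Set a} {x y : A} {i j : ℕ} → i ≡ j → (if i ≡ᵇ j then x else y) ≡ x
if-≡ᵇ-yes {i = i} {j} i≡j with i ≡ᵇ j | ℕₚ.≡⇒≡ᵇ i j i≡j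
... | true  | _  = ≡.refl
... | false | ()

if-≡ᵇ-no : ∀ {a} {A : Set a} {x y : A} {i j : ℕ} → i ≢ j → (if i ≡ᵇ j then x else y) ≡ y
if-≡ᵇ-no {i = i} {j} i≢j with i ≡ᵇ j | ℕₚ.≡ᵇ⇒≡ i j
... | false | _     = ≡.refl
... | true  | sound = ⊥-elim (i≢j (sound _))

pred<⇒≤ : ∀ j {b} → j ∸ 1 < b → j ≤ b
pred<⇒≤ zero    _   = z≤n
pred<⇒≤ (suc j) j<b = j<b

≤pred⇒< : ∀ {j a b} → j ≤ b ∸ 1 → a < b → j < b
≤pred⇒< j≤b-1 (s≤s _) = s≤s j≤b-1

module MatrixAlgebra {c ℓ : Level} (F : Field c ℓ) (n : ℕ) where
  open Field F hiding (zero)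
  open SetoidReasoning setoid
  open Matrices F n

  data τ-View (j a : ℕ) : Set where
    at-pred : a ≡ j ∸ 1 → τ j a ≡ j → τ-View j a
    at-j    : a ≡ j → τ j a ≡ j ∸ 1 → τ-View j a
    away    : a ≢ j ∸ 1 → a ≢ j → τ j a ≡ a → τ-View j a

  τ-view : ∀ j a → τ-View j a
  τ-view j a with a ≟ j ∸ 1 | a ≟ j
  ... | yes a≡j-1 | _       = at-pred a≡j-1 (if-≡ᵇ-yes a≡j-1)
  ... | no  a≢j-1 | yes a≡j = at-j a≡j (≡.trans (if-≡ᵇ-no a≢j-1) (if-≡ᵇ-yes a≡j))
  ... | no  a≢j-1 | no  a≢j = away a≢j-1 a≢j (≡.trans (if-≡ᵇ-no a≢j-1) (if-≡ᵇ-no a≢j))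

  τ-at-pred : ∀ j → τ j (j ∸ 1) ≡ j
  τ-at-pred j with τ-view j (j ∸ 1)
  ... | at-pred _ e     = e
  ... | at-j j-1≡j e    = ≡.trans e j-1≡j
  ... | away j-1≢j-1 _ _ = contradiction ≡.refl j-1≢j-1

  τ-at-j : ∀ j → τ j j ≡ j ∸ 1
  τ-at-j j with τ-view j j
  ... | at-pred j≡j-1 e = ≡.trans e j≡j-1
  ... | at-j _ e        = e
  ... | away _ j≢j _    = contradiction ≡.refl j≢j

  τ-involutive : ∀ j a → τ j (τ j a) ≡ a
  τ-involutive j a with τ-view j a
  ... | at-pred a≡j-1 e = ≡.trans (≡.cong (τ j) e) (≡.trans (τ-at-j j) (≡.sym a≡j-1))
  ... | at-j a≡j e      = ≡.trans (≡.cong (τ j) e) (≡.trans (τ-at-pred j) (≡.sym a≡j))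
  ... | away _ _ e      = ≡.trans (≡.cong (τ j) e) e

  -- τ j maps the initial segment {a < b} into itself unless j = b: only the
  -- transposition of b ∸ 1 and b crosses the cut.
  τ-< : ∀ {j a b} → j ≢ b → a < b → τ j a < b
  τ-< {j} {a} {b} j≢b a<b with τ-view j a
  ... | at-pred a≡j-1 e = ≡.subst (_< b) (≡.sym e)
          (ℕₚ.≤∧≢⇒< (pred<⇒≤ j (≡.subst (_< b) a≡j-1 a<b)) j≢b)
  ... | at-j a≡j e      = ≡.subst (_< b) (≡.sym e)
          (ℕₚ.≤-<-trans (ℕₚ.m∸n≤m j 1) (≡.subst (_< b) a≡j a<b))
  ... | away _ _ e      = ≡.subst (_< b) (≡.sym e) a<b

  τ-fix-above : ∀ {j a} → j < a → τ j a ≡ a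
  τ-fix-above {j} {a} j<a with τ-view j a
  ... | at-pred a≡j-1 _ = ⊥-elim (ℕₚ.<-irrefl (≡.sym a≡j-1) (ℕₚ.≤-<-trans (ℕₚ.m∸n≤m j 1) j<a))
  ... | at-j a≡j _      = ⊥-elim (ℕₚ.<-irrefl (≡.sym a≡j) j<a)
  ... | away _ _ e      = e

  τ-fix-below : ∀ {j a} → suc a < j → τ j a ≡ a
  τ-fix-below {j} {a} 1+a<j with τ-view j a
  ... | at-pred a≡j-1 _ = ⊥-elim (ℕₚ.<⇒≱ 1+a<j
          (pred<⇒≤ j (≡.subst (_< suc a) a≡j-1 (ℕₚ.n<1+n a))))
  ... | at-j a≡j _      = ⊥-elim (ℕₚ.<-irrefl a≡j (ℕₚ.<-trans (ℕₚ.n<1+n a) 1+a<j))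
  ... | away _ _ e      = e

  -- A letter j of a word is usable on indices 0 … n ∸ 1 when j ≤ n ∸ 1.
  Letter : ℕ → Set
  Letter j = j ≤ n ∸ 1

  -- τ j acting on Fin n; the fallback branch is never taken for letters.
  τF : ℕ → Fin n → Fin n
  τF j i with τ j (toℕ i) <? n
  ... | yes τi<n = fromℕ< τi<n
  ... | no  _    = i

  τF-toℕ : ∀ {j} → Letter j → ∀ i → toℕ (τF j i) ≡ τ j (toℕ i)
  τF-toℕ {j} j≤n-1 i with τ j (toℕ i) <? n
  ... | yes τi<n = Finₚ.toℕ-fromℕ< τi<n
  ... | no  τi≮n = contradiction (τ-< (ℕₚ.<⇒≢ (≤pred⇒< j≤n-1 (Finₚ.toℕ<n i))) (Finₚ.toℕ<n i)) τi≮n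

  τF-involutive : ∀ {j} → Letter j → ∀ i → τF j (τF j i) ≡ i
  τF-involutive {j} j≤n-1 i = Finₚ.toℕ-injective (≡.trans (τF-toℕ j≤n-1 (τF j i))
    (≡.trans (≡.cong (τ j) (τF-toℕ j≤n-1 i)) (τ-involutive j (toℕ i))))

  module Σ = SemiringSum semiring

  ΣF≡sum : ∀ {k} (f : Fin k → Carrier) → ΣF f ≡ Σ.sum f
  ΣF≡sum {zero}  f = ≡.refl
  ΣF≡sum {suc k} f = ≡.cong (f Fin.zero +_) (ΣF≡sum (λ i → f (Fin.suc i)))

  ΣF≈sum : ∀ {k} (f : Fin k → Carrier) → ΣF f ≈ Σ.sum f
  ΣF≈sum f = reflexive (ΣF≡sum f)

  ΣF-cong : ∀ {k} {f g : Fin k → Carrier} → (∀ i → f i ≈ g i) → ΣF f ≈ ΣF g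
  ΣF-cong {f = f} {g} f≈g = begin
    ΣF f     ≈⟨ ΣF≈sum f ⟩
    Σ.sum f  ≈⟨ Σ.sum-cong-≋ f≈g ⟩
    Σ.sum g  ≈⟨ ΣF≈sum g ⟨
    ΣF g     ∎

  sum-zero : ∀ {k} {f : Fin k → Carrier} → (∀ i → f i ≈ 0#) → Σ.sum f ≈ 0#
  sum-zero {k} f≈0 = trans (Σ.sum-cong-≋ f≈0) (Σ.sum-replicate-zero k)

  ΣF-zero : ∀ {k} {f : Fin k → Carrier} → (∀ i → f i ≈ 0#) → ΣF f ≈ 0#
  ΣF-zero {f = f} f≈0 = trans (ΣF≈sum f) (sum-zero f≈0)

  ΣF-single : ∀ {k} {f : Fin k → Carrier} (j : Fin k) → (∀ i → i ≢ j → f i ≈ 0#) → ΣF f ≈ f j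
  ΣF-single {suc k} {f} j rest = begin
    ΣF f                                     ≈⟨ ΣF≈sum f ⟩
    Σ.sum f                                  ≈⟨ Σ.sum-remove f ⟩
    f j + Σ.sum (λ i → f (punchIn j i))      ≈⟨ +-congˡ (sum-zero (λ i → rest _ (Finₚ.punchInᵢ≢i j i))) ⟩
    f j + 0#                                 ≈⟨ +-identityʳ (f j) ⟩
    f j                                      ∎

  ΣF-*ˡ : ∀ {k} x (f : Fin k → Carrier) → x * ΣF f ≈ ΣF (λ i → x * f i)
  ΣF-*ˡ x f = begin
    x * ΣF f                  ≈⟨ *-congˡ (ΣF≈sum f) ⟩
    x * Σ.sum f               ≈⟨ Σ.*-distribˡ-sum x f ⟩
    Σ.sum (λ i → x * f i)     ≈⟨ ΣF≈sum (λ i → x * f i) ⟨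
    ΣF (λ i → x * f i)        ∎

  ΣF-*ʳ : ∀ {k} x (f : Fin k → Carrier) → ΣF f * x ≈ ΣF (λ i → f i * x)
  ΣF-*ʳ x f = begin
    ΣF f * x                  ≈⟨ *-congʳ (ΣF≈sum f) ⟩
    Σ.sum f * x               ≈⟨ Σ.*-distribʳ-sum x f ⟩
    Σ.sum (λ i → f i * x)     ≈⟨ ΣF≈sum (λ i → f i * x) ⟨
    ΣF (λ i → f i * x)        ∎

  ΣF-swap : ∀ {k k′} (f : Fin k → Fin k′ → Carrier) →
            ΣF (λ i → ΣF (λ j → f i j)) ≈ ΣF (λ j → ΣF (λ i → f i j))
  ΣF-swap f = begin
    ΣF (λ i → ΣF (λ j → f i j))        ≈⟨ ΣF-cong (λ i → ΣF≈sum (f i)) ⟩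
    ΣF (λ i → Σ.sum (λ j → f i j))     ≈⟨ ΣF≈sum (λ i → Σ.sum (λ j → f i j)) ⟩
    Σ.sum (λ i → Σ.sum (λ j → f i j))  ≈⟨ Σ.∑-comm f ⟩
    Σ.sum (λ j → Σ.sum (λ i → f i j))  ≈⟨ ΣF≈sum (λ j → Σ.sum (λ i → f i j)) ⟨
    ΣF (λ j → Σ.sum (λ i → f i j))     ≈⟨ ΣF-cong (λ j → ΣF≈sum (λ i → f i j)) ⟨
    ΣF (λ j → ΣF (λ i → f i j))        ∎

  annihilˡ : ∀ {x y} → x ≈ 0# → x * y ≈ 0#
  annihilˡ {y = y} x≈0 = trans (*-congʳ x≈0) (zeroˡ y)

  annihilʳ : ∀ {x y} → y ≈ 0# → x * y ≈ 0#
  annihilʳ {x} y≈0 = trans (*-congˡ y≈0) (zeroʳ x)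

  -- Matrices form a monoid under ⊗; the bundle feeds the monoid solver,
  -- which reassociates long products.
  I-diag : ∀ i → I i i ≡ 1#
  I-diag i = if-≡ᵇ-yes {i = toℕ i} ≡.refl

  I-off : ∀ {i j} → i ≢ j → I i j ≡ 0#
  I-off i≢j = if-≡ᵇ-no (λ e → i≢j (Finₚ.toℕ-injective e))

  ≈ᴹ-isEquivalence : IsEquivalence _≈ᴹ_
  ≈ᴹ-isEquivalence = record
    { refl  = λ i j → refl
    ; sym   = λ A≈B i j → sym (A≈B i j)
    ; trans = λ A≈B B≈C i j → trans (A≈B i j) (B≈C i j)
    }

  open IsEquivalence ≈ᴹ-isEquivalence using ()
    renaming (refl to ≈ᴹ-refl; sym to ≈ᴹ-sym; trans to ≈ᴹ-trans)

  ⊗-cong : ∀ {A A′ B B′} → A ≈ᴹ A′ → B ≈ᴹ B′ → A ⊗ B ≈ᴹ A′ ⊗ B′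
  ⊗-cong A≈A′ B≈B′ i j = ΣF-cong (λ l → *-cong (A≈A′ i l) (B≈B′ l j))

  ⊗-assoc : ∀ A B C → (A ⊗ B) ⊗ C ≈ᴹ A ⊗ (B ⊗ C)
  ⊗-assoc A B C i j = begin
    ΣF (λ l → ΣF (λ p → A i p * B p l) * C l j)    ≈⟨ ΣF-cong (λ l → ΣF-*ʳ (C l j) (λ p → A i p * B p l)) ⟩
    ΣF (λ l → ΣF (λ p → A i p * B p l * C l j))    ≈⟨ ΣF-swap (λ l p → A i p * B p l * C l j) ⟩
    ΣF (λ p → ΣF (λ l → A i p * B p l * C l j))    ≈⟨ ΣF-cong (λ p → ΣF-cong (λ l → *-assoc (A i p) (B p l) (C l j))) ⟩
    ΣF (λ p → ΣF (λ l → A i p * (B p l * C l j)))  ≈⟨ ΣF-cong (λ p → ΣF-*ˡ (A i p) (λ l → B p l * C l j)) ⟨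
    ΣF (λ p → A i p * ΣF (λ l → B p l * C l j))    ∎

  ⊗-identityˡ : ∀ A → I ⊗ A ≈ᴹ A
  ⊗-identityˡ A i j = begin
    ΣF (λ l → I i l * A l j)  ≈⟨ ΣF-single i (λ l l≢i → annihilˡ (reflexive (I-off (λ i≡l → l≢i (≡.sym i≡l))))) ⟩
    I i i * A i j             ≈⟨ *-congʳ (reflexive (I-diag i)) ⟩
    1# * A i j                ≈⟨ *-identityˡ (A i j) ⟩
    A i j                     ∎

  ⊗-identityʳ : ∀ A → A ⊗ I ≈ᴹ A
  ⊗-identityʳ A i j = begin
    ΣF (λ l → A i l * I l j)  ≈⟨ ΣF-single j (λ l l≢j → annihilʳ (reflexive (I-off l≢j))) ⟩
    A i j * I j j             ≈⟨ *-congˡ (reflexive (I-diag j)) ⟩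
    A i j * 1#                ≈⟨ *-identityʳ (A i j) ⟩
    A i j                     ∎

  matrixMonoid : Monoid c ℓ
  matrixMonoid = record
    { Carrier  = Mat
    ; _≈_      = _≈ᴹ_
    ; _∙_      = _⊗_
    ; ε        = I
    ; isMonoid = record
      { isSemigroup = record
        { isMagma = record { isEquivalence = ≈ᴹ-isEquivalence ; ∙-cong = ⊗-cong }
        ; assoc   = ⊗-assoc
        }
      ; identity = ⊗-identityˡ , ⊗-identityʳ
      }
    }

  wgen-1 : ∀ {j} a b → toℕ a ≡ τ j (toℕ b) → wgen j a b ≡ 1#
  wgen-1 a b a≡τb = if-≡ᵇ-yes a≡τb

  wgen-0 : ∀ {j} a b → toℕ a ≢ τ j (toℕ b) → wgen j a b ≡ 0#
  wgen-0 a b a≢τb = if-≡ᵇ-no a≢τb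

  wgen-⊗ : ∀ {j} → Letter j → ∀ A a l → (wgen j ⊗ A) a l ≈ A (τF j a) l
  wgen-⊗ {j} j≤n-1 A a l = begin
    ΣF (λ b → wgen j a b * A b l)          ≈⟨ ΣF-single (τF j a) off ⟩
    wgen j a (τF j a) * A (τF j a) l       ≈⟨ *-congʳ (reflexive (wgen-1 a (τF j a) a≡ττa)) ⟩
    1# * A (τF j a) l                      ≈⟨ *-identityˡ _ ⟩
    A (τF j a) l                           ∎
    where
    a≡ττa : toℕ a ≡ τ j (toℕ (τF j a))
    a≡ττa = ≡.sym (≡.trans (≡.cong (τ j) (τF-toℕ j≤n-1 a)) (τ-involutive j (toℕ a)))
    off : ∀ b → b ≢ τF j a → wgen j a b * A b l ≈ 0#
    off b b≢τa = annihilˡ (reflexive (wgen-0 a b (λ a≡τb → b≢τa (Finₚ.toℕ-injective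
      (≡.trans (≡.sym (τ-involutive j (toℕ b)))
        (≡.trans (≡.cong (τ j) (≡.sym a≡τb)) (≡.sym (τF-toℕ j≤n-1 a))))))))

  ⊗-wgen : ∀ {j} → Letter j → ∀ A i b → (A ⊗ wgen j) i b ≈ A i (τF j b)
  ⊗-wgen {j} j≤n-1 A i b = begin
    ΣF (λ a → A i a * wgen j a b)          ≈⟨ ΣF-single (τF j b) off ⟩
    A i (τF j b) * wgen j (τF j b) b       ≈⟨ *-congˡ (reflexive (wgen-1 (τF j b) b (τF-toℕ j≤n-1 b))) ⟩
    A i (τF j b) * 1#                      ≈⟨ *-identityʳ _ ⟩
    A i (τF j b)                           ∎
    where
    off : ∀ a → a ≢ τF j b → A i a * wgen j a b ≈ 0#
    off a a≢τb = annihilʳ (reflexive (wgen-0 a b (λ a≡τb → a≢τb (Finₚ.toℕ-injective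
      (≡.trans a≡τb (≡.sym (τF-toℕ j≤n-1 b)))))))

  πF : List ℕ → Fin n → Fin n
  πF []      i = i
  πF (j ∷ w) i = πF w (τF j i)

  word-⊗ : ∀ {w} → All Letter w → ∀ A a l → (word w ⊗ A) a l ≈ A (πF w a) l
  word-⊗ []                        A a l = ⊗-identityˡ A a l
  word-⊗ {j ∷ w} (j≤n-1 ∷ w-letters) A a l = begin
    ((wgen j ⊗ word w) ⊗ A) a l  ≈⟨ ⊗-assoc (wgen j) (word w) A a l ⟩
    (wgen j ⊗ (word w ⊗ A)) a l  ≈⟨ wgen-⊗ j≤n-1 (word w ⊗ A) a l ⟩
    (word w ⊗ A) (τF j a) l      ≈⟨ word-⊗ w-letters A (τF j a) l ⟩
    A (πF w (τF j a)) l          ∎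

  word-∷ʳ : ∀ w j → word (w ∷ʳ j) ≈ᴹ word w ⊗ wgen j
  word-∷ʳ []      j = ≈ᴹ-trans (⊗-identityʳ (wgen j)) (≈ᴹ-sym (⊗-identityˡ (wgen j)))
  word-∷ʳ (x ∷ w) j = ≈ᴹ-trans (⊗-cong (≈ᴹ-refl {wgen x}) (word-∷ʳ w j))
                                (≈ᴹ-sym (⊗-assoc (wgen x) (word w) (wgen j)))

  ⊗-word-reverse : ∀ {w} → All Letter w → ∀ A i l → (A ⊗ word (reverse w)) i l ≈ A i (πF w l)
  ⊗-word-reverse []                        A i l = ⊗-identityʳ A i l
  ⊗-word-reverse {j ∷ w} (j≤n-1 ∷ w-letters) A i l = begin
    (A ⊗ word (reverse (j ∷ w))) i l          ≡⟨ ≡.cong (λ v → (A ⊗ word v) i l) (Listₚ.unfold-reverse j w) ⟩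
    (A ⊗ word (reverse w ∷ʳ j)) i l           ≈⟨ ⊗-cong (≈ᴹ-refl {A}) (word-∷ʳ (reverse w) j) i l ⟩
    (A ⊗ (word (reverse w) ⊗ wgen j)) i l     ≈⟨ ⊗-assoc A (word (reverse w)) (wgen j) i l ⟨
    ((A ⊗ word (reverse w)) ⊗ wgen j) i l     ≈⟨ ⊗-wgen j≤n-1 (A ⊗ word (reverse w)) i l ⟩
    (A ⊗ word (reverse w)) i (τF j l)         ≈⟨ ⊗-word-reverse w-letters A i (τF j l) ⟩
    A i (πF w (τF j l))                       ∎

  conjugate-entry : ∀ {w} → All Letter w → ∀ Y i l →
                    (word w ⊗ (Y ⊗ word (reverse w))) i l ≈ Y (πF w i) (πF w l)
  conjugate-entry {w} w-letters Y i l =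
    trans (word-⊗ w-letters (Y ⊗ word (reverse w)) i l) (⊗-word-reverse w-letters Y (πF w i) l)

  πF⁻¹ : List ℕ → Fin n → Fin n
  πF⁻¹ []      x = x
  πF⁻¹ (j ∷ w) x = τF j (πF⁻¹ w x)

  πF-πF⁻¹ : ∀ {w} → All Letter w → ∀ x → πF w (πF⁻¹ w x) ≡ x
  πF-πF⁻¹ []                        x = ≡.refl
  πF-πF⁻¹ {j ∷ w} (j≤n-1 ∷ w-letters) x =
    ≡.trans (≡.cong (πF w) (τF-involutive j≤n-1 (πF⁻¹ w x))) (πF-πF⁻¹ w-letters x)

  Parabolic : ℕ → Mat → Set ℓ
  Parabolic k A = ∀ i j → toℕ j < k → k ≤ toℕ i → A i j ≈ 0#

  Parabolic-cong : ∀ {k A B} → A ≈ᴹ B → Parabolic k A → Parabolic k B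
  Parabolic-cong A≈B A∈P i j j<k k≤i = trans (sym (A≈B i j)) (A∈P i j j<k k≤i)

  Parabolic-⊗ : ∀ {k A B} → Parabolic k A → Parabolic k B → Parabolic k (A ⊗ B)
  Parabolic-⊗ {k} {A} {B} A∈P B∈P i j j<k k≤i = ΣF-zero vanish
    where
    vanish : ∀ l → A i l * B l j ≈ 0#
    vanish l with toℕ l <? k
    ... | yes l<k = annihilˡ (A∈P i l l<k k≤i)
    ... | no  l≮k = annihilʳ (B∈P l j j<k (ℕₚ.≮⇒≥ l≮k))

  UT⇒Parabolic : ∀ {k A} → UpperTriangular A → Parabolic k A
  UT⇒Parabolic A-ut i j j<k k≤i = A-ut i j (ℕₚ.<-≤-trans j<k k≤i)

  Parabolic-I : ∀ {k} → Parabolic k I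
  Parabolic-I i j j<k k≤i =
    reflexive (I-off (λ i≡j → ℕₚ.<-irrefl (≡.cong toℕ (≡.sym i≡j)) (ℕₚ.<-≤-trans j<k k≤i)))

  Parabolic-wgen : ∀ {k j} → j ≢ k → Parabolic k (wgen j)
  Parabolic-wgen {k} {j} j≢k a b b<k k≤a = reflexive (wgen-0 a b (λ a≡τb →
    ℕₚ.<⇒≱ (≡.subst (_< k) (≡.sym a≡τb) (τ-< j≢k b<k)) k≤a))

  Parabolic-word : ∀ {k w} → All (_≢ k) w → Parabolic k (word w)
  Parabolic-word []                = Parabolic-I
  Parabolic-word (j≢k ∷ w-avoids-k) = Parabolic-⊗ (Parabolic-wgen j≢k) (Parabolic-word w-avoids-k)

  Parabolic-cell : ∀ {k w M} → All (_≢ k) w → InCell (word w) M → Parabolic k M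
  Parabolic-cell w-avoids-k (b₁ , b₂ , (b₁-ut , _) , (b₂-ut , _) , M≈) =
    Parabolic-cong (≈ᴹ-sym M≈)
      (Parabolic-⊗ (Parabolic-⊗ (UT⇒Parabolic b₁-ut) (Parabolic-word w-avoids-k)) (UT⇒Parabolic b₂-ut))

  Unit : Carrier → Set (c ⊔ ℓ)
  Unit x = ∃[ v ] (v * x ≈ 1#)

  module *-Properties = CommutativeSemigroupProperties *-commutativeSemigroup

  Unit-* : ∀ {x y} → Unit x → Unit y → Unit (x * y)
  Unit-* {x} {y} (u , ux≈1) (v , vy≈1) =
    u * v , trans (*-Properties.interchange u v x y) (trans (*-cong ux≈1 vy≈1) (*-identityˡ 1#))

  Unit⇒≉0 : ∀ {x} → Unit x → ¬ (x ≈ 0#)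
  Unit⇒≉0 (v , vx≈1) x≈0 = 0≉1 (trans (sym (annihilʳ x≈0)) vx≈1)

  Unit-cancelˡ : ∀ {u x} → Unit u → u * x ≈ 0# → x ≈ 0#
  Unit-cancelˡ {u} {x} (v , vu≈1) ux≈0 = begin
    x            ≈⟨ *-identityˡ x ⟨
    1# * x       ≈⟨ *-congʳ vu≈1 ⟨
    v * u * x    ≈⟨ *-assoc v u x ⟩
    v * (u * x)  ≈⟨ annihilʳ ux≈0 ⟩
    0#           ∎

  Unit-cancelʳ : ∀ {u x} → Unit u → x * u ≈ 0# → x ≈ 0#
  Unit-cancelʳ {u} {x} u-unit xu≈0 = Unit-cancelˡ u-unit (trans (*-comm u x) xu≈0)

  UnitUT : Mat → Set (c ⊔ ℓ)
  UnitUT A = UpperTriangular A × (∀ j → Unit (A j j))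

  ≢⇒<⊎> : ∀ {a b : Fin n} → a ≢ b → toℕ a < toℕ b ⊎ toℕ b < toℕ a
  ≢⇒<⊎> {a} {b} a≢b with ℕₚ.<-cmp (toℕ a) (toℕ b)
  ... | tri< a<b _ _ = inj₁ a<b
  ... | tri≈ _ a≡b _ = contradiction (Finₚ.toℕ-injective a≡b) a≢b
  ... | tri> _ _ b<a = inj₂ b<a

  UT-⊗ : ∀ {A B} → UpperTriangular A → UpperTriangular B → UpperTriangular (A ⊗ B)
  UT-⊗ {A} {B} A-ut B-ut i j j<i = ΣF-zero vanish
    where
    vanish : ∀ l → A i l * B l j ≈ 0#
    vanish l with toℕ l <? toℕ i
    ... | yes l<i = annihilˡ (A-ut i l l<i)
    ... | no  l≮i = annihilʳ (B-ut l j (ℕₚ.<-≤-trans j<i (ℕₚ.≮⇒≥ l≮i)))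

  diag-⊗ : ∀ {A B} → UpperTriangular A → UpperTriangular B → ∀ j → (A ⊗ B) j j ≈ A j j * B j j
  diag-⊗ {A} {B} A-ut B-ut j = ΣF-single j off
    where
    off : ∀ l → l ≢ j → A j l * B l j ≈ 0#
    off l l≢j with ≢⇒<⊎> l≢j
    ... | inj₁ l<j = annihilˡ (A-ut j l l<j)
    ... | inj₂ j<l = annihilʳ (B-ut l j j<l)

  UnitUT-⊗ : ∀ {A B} → UnitUT A → UnitUT B → UnitUT (A ⊗ B)
  UnitUT-⊗ (A-ut , A-diag) (B-ut , B-diag) = UT-⊗ A-ut B-ut , λ j →
    let (v , v*AB≈1) = Unit-* (A-diag j) (B-diag j)
    in  v , trans (*-congˡ (diag-⊗ A-ut B-ut j)) v*AB≈1

  -- Induction over the columns, left to right: once b′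
  -- vanishes below the diagonal in the columns before j, entry (i, j) of
  -- b′ ⊗ b is the single product b′ i j * b j j.
  module LeftInverse {b b′ : Mat} (b-ut : UpperTriangular b) (b′b≈I : b′ ⊗ b ≈ᴹ I) where
    LowerZeroBefore : ℕ → Set ℓ
    LowerZeroBefore t = ∀ i j → toℕ j < t → toℕ j < toℕ i → b′ i j ≈ 0#

    column-entry : ∀ j → LowerZeroBefore (toℕ j) → ∀ i → toℕ j ≤ toℕ i →
                   (b′ ⊗ b) i j ≈ b′ i j * b j j
    column-entry j before-j i j≤i = ΣF-single j off
      where
      off : ∀ l → l ≢ j → b′ i l * b l j ≈ 0#
      off l l≢j with ≢⇒<⊎> l≢j
      ... | inj₁ l<j = annihilˡ (before-j i l l<j (ℕₚ.<-≤-trans l<j j≤i))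
      ... | inj₂ j<l = annihilʳ (b-ut l j j<l)

    diagonal : ∀ j → LowerZeroBefore (toℕ j) → b′ j j * b j j ≈ 1#
    diagonal j before-j =
      trans (sym (column-entry j before-j j ℕₚ.≤-refl)) (trans (b′b≈I j j) (reflexive (I-diag j)))

    lower-zero : ∀ t → LowerZeroBefore t
    lower-zero (suc t) i j (s≤s j≤t) j<i with ℕₚ.m≤n⇒m<n∨m≡n j≤t
    ... | inj₁ j<t = lower-zero t i j j<t j<i
    ... | inj₂ j≡t = Unit-cancelʳ (b′ j j , diagonal j before-j) (begin
      b′ i j * b j j  ≈⟨ column-entry j before-j i (ℕₚ.<⇒≤ j<i) ⟨
      (b′ ⊗ b) i j    ≈⟨ b′b≈I i j ⟩
      I i j           ≈⟨ reflexive (I-off (λ i≡j → ℕₚ.<-irrefl (≡.cong toℕ (≡.sym i≡j)) j<i)) ⟩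
      0#              ∎)
      where
      before-j : LowerZeroBefore (toℕ j)
      before-j = ≡.subst LowerZeroBefore (≡.sym j≡t) (lower-zero t)

    left-inverse-UT : UpperTriangular b′ × (∀ j → Unit (b j j))
    left-inverse-UT = (λ i j j<i → lower-zero (suc (toℕ j)) i j ℕₚ.≤-refl j<i)
                    , (λ j → b′ j j , diagonal j (lower-zero (toℕ j)))

  open LeftInverse using (left-inverse-UT)

  InB⇒UnitUT : ∀ {b} → InB b → UnitUT b
  InB⇒UnitUT (b-ut , _ , _ , b′b≈I) = b-ut , proj₂ (left-inverse-UT b-ut b′b≈I)

  -- If M ∈ C(U) C(V) C(X) lies in P_k, cancelling the outer Borel factors shows
  -- that U (β V β′) X lies in P_k for some β, β′ ∈ B.
  conjugate-in-parabolic : ∀ {k U V X M} → InCell³ U V X M → Parabolic k M →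
    ∃[ β ] ∃[ β′ ] (UnitUT β × UnitUT β′ × Parabolic k (U ⊗ ((β ⊗ (V ⊗ β′)) ⊗ X)))
  conjugate-in-parabolic {_} {U} {V} {X} {M}
    (_ , _ , _ , (b₁ , b₂ , (b₁-ut , b₁⁻¹ , _ , b₁⁻¹b₁≈I) , b₂∈B , P≈) , (b₃ , b₄ , b₃∈B , b₄∈B , Q≈) ,
     (b₅ , b₆ , b₅∈B , (b₆-ut , b₆⁻¹ , b₆b₆⁻¹≈I , b₆⁻¹b₆≈I) , R≈) , M≈PQR) M∈P =
    β , β′ , UnitUT-⊗ (InB⇒UnitUT b₂∈B) (InB⇒UnitUT b₃∈B) , UnitUT-⊗ (InB⇒UnitUT b₄∈B) (InB⇒UnitUT b₅∈B) ,
    Parabolic-cong cancel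
      (Parabolic-⊗ (UT⇒Parabolic (proj₁ (left-inverse-UT b₁-ut b₁⁻¹b₁≈I)))
        (Parabolic-⊗ M∈P (UT⇒Parabolic (proj₁ (left-inverse-UT b₆-ut b₆⁻¹b₆≈I)))))
    where
    open MonoidSolver matrixMonoid using (solve; _⊜_; _⊕_)
    β β′ Z : Mat
    β  = b₂ ⊗ b₃
    β′ = b₄ ⊗ b₅
    Z  = U ⊗ ((β ⊗ (V ⊗ β′)) ⊗ X)
    M≈ : M ≈ᴹ (((b₁ ⊗ U) ⊗ b₂) ⊗ ((b₃ ⊗ V) ⊗ b₄)) ⊗ ((b₅ ⊗ X) ⊗ b₆)
    M≈ = ≈ᴹ-trans M≈PQR (⊗-cong (⊗-cong P≈ Q≈) R≈)
    regroup : b₁⁻¹ ⊗ ((((b₁ ⊗ U) ⊗ b₂) ⊗ ((b₃ ⊗ V) ⊗ b₄)) ⊗ ((b₅ ⊗ X) ⊗ b₆) ⊗ b₆⁻¹)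
              ≈ᴹ ((b₁⁻¹ ⊗ b₁) ⊗ Z) ⊗ (b₆ ⊗ b₆⁻¹)
    regroup = solve 11 (λ y₁ x₁ u x₂ x₃ v x₄ x₅ x x₆ y₆ →
        (y₁ ⊕ (((((x₁ ⊕ u) ⊕ x₂) ⊕ ((x₃ ⊕ v) ⊕ x₄)) ⊕ ((x₅ ⊕ x) ⊕ x₆)) ⊕ y₆))
      ⊜ (((y₁ ⊕ x₁) ⊕ (u ⊕ (((x₂ ⊕ x₃) ⊕ (v ⊕ (x₄ ⊕ x₅))) ⊕ x))) ⊕ (x₆ ⊕ y₆)))
      (λ i j → refl) b₁⁻¹ b₁ U b₂ b₃ V b₄ b₅ X b₆ b₆⁻¹
    cancel : b₁⁻¹ ⊗ (M ⊗ b₆⁻¹) ≈ᴹ Z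
    cancel = ≈ᴹ-trans (⊗-cong (≈ᴹ-refl {b₁⁻¹}) (⊗-cong M≈ (≈ᴹ-refl {b₆⁻¹})))
            (≈ᴹ-trans regroup
            (≈ᴹ-trans (⊗-cong (⊗-cong b₁⁻¹b₁≈I (≈ᴹ-refl {Z})) b₆b₆⁻¹≈I)
            (≈ᴹ-trans (⊗-identityʳ (I ⊗ Z)) (⊗-identityˡ Z))))

module Bruhat {c ℓ : Level} (F : Field c ℓ) (m : ℕ) where
  open Field F hiding (zero)
  open SetoidReasoning setoid
  open Matrices F (suc m)
  open MatrixAlgebra F (suc m)

  last : Fin (suc m)
  last = fromℕ m

  toℕ-last : toℕ last ≡ m
  toℕ-last = Finₚ.toℕ-fromℕ m

  below-last : ∀ {a} → a ≢ last → toℕ a < m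
  below-last {a} a≢last = ℕₚ.≤∧≢⇒< (ℕₚ.≤-pred (Finₚ.toℕ<n a))
    (λ a≡m → a≢last (Finₚ.toℕ-injective (≡.trans a≡m (≡.sym toℕ-last))))

  πℕ : List ℕ → ℕ → ℕ
  πℕ []      a = a
  πℕ (j ∷ w) a = πℕ w (τ j a)

  πF-toℕ : ∀ {w} → All Letter w → ∀ i → toℕ (πF w i) ≡ πℕ w (toℕ i)
  πF-toℕ []                        i = ≡.refl
  πF-toℕ {j ∷ w} (j≤n-1 ∷ w-letters) i =
    ≡.trans (πF-toℕ w-letters (τF j i)) (≡.cong (πℕ w) (τF-toℕ j≤n-1 i))

  πℕ-fix : ∀ {w a} → All (_< a) w → πℕ w a ≡ a
  πℕ-fix []                 = ≡.refl
  πℕ-fix {j ∷ w} (j<a ∷ w<a) = ≡.trans (≡.cong (πℕ w) (τ-fix-above j<a)) (πℕ-fix w<a)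

  πF-fix-last : ∀ {w} → All Letter w → All (_< m) w → πF w last ≡ last
  πF-fix-last {w} w-letters w<m = Finₚ.toℕ-injective
    (≡.trans (πF-toℕ w-letters last) (≡.trans (≡.cong (πℕ w) toℕ-last)
      (≡.trans (πℕ-fix w<m) (≡.sym toℕ-last))))

  coxeter : ℕ → List ℕ
  coxeter t = map suc (downFrom t)

  coxeter-bounded : ∀ t → All (_≤ t) (coxeter t)
  coxeter-bounded zero    = []
  coxeter-bounded (suc t) = ℕₚ.≤-refl ∷ All.map ℕₚ.m≤n⇒m≤1+n (coxeter-bounded t)

  coxeter-top : ∀ t → πℕ (coxeter t) t ≡ 0
  coxeter-top zero    = ≡.refl
  coxeter-top (suc t) = ≡.trans (≡.cong (πℕ (coxeter t)) (τ-at-j (suc t))) (coxeter-top t)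

  coxeter-below : ∀ t a → a < t → πℕ (coxeter t) a ≡ suc a
  coxeter-below (suc t) a (s≤s a≤t) with a ≟ t
  ... | yes ≡.refl = ≡.trans (≡.cong (πℕ (coxeter a)) (τ-at-pred (suc a)))
                             (πℕ-fix (All.map s≤s (coxeter-bounded a)))
  ... | no  a≢t    = ≡.trans (≡.cong (πℕ (coxeter t)) (τ-fix-below (s≤s a<t))) (coxeter-below t a a<t)
    where
    a<t : a < t
    a<t = ℕₚ.≤∧≢⇒< a≤t a≢t

  cox-letters : All Letter cox
  cox-letters = coxeter-bounded m

  πF-cox-last : toℕ (πF cox last) ≡ 0
  πF-cox-last = ≡.trans (πF-toℕ cox-letters last)
    (≡.trans (≡.cong (πℕ cox) toℕ-last) (coxeter-top m))

  πF-cox-below : ∀ a → toℕ a < m → toℕ (πF cox a) ≡ suc (toℕ a)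
  πF-cox-below a a<m = ≡.trans (πF-toℕ cox-letters a) (coxeter-below m (toℕ a) a<m)

  SuperdiagonalWitness : Mat → Set ℓ
  SuperdiagonalWitness Y =
    ∀ s → Y last s ≈ 0# → Σ[ p ∈ Fin (suc m) ] (suc (toℕ p) ≡ toℕ s × ¬ (Y p s ≈ 0#))

  -- β c β′ has superdiagonal witnesses for β, β′ ∈ B: its (i, s) entry is
  -- Σ_a β i a β′ (σ a) s with σ = πF cox, and triangularity leaves one term in
  -- the bottom row (a = last, σ a = 0) and at position (p, p + 1) (a = p).
  coxeter-witness : ∀ {β β′} → UnitUT β → UnitUT β′ → SuperdiagonalWitness (β ⊗ (word cox ⊗ β′))
  coxeter-witness {β} {β′} (β-ut , β-diag) (β′-ut , β′-diag) s Y[last,s]≈0 = witness s β′[0,s]≈0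
    where
    σ : Fin (suc m) → Fin (suc m)
    σ = πF cox

    σ-last : σ last ≡ Fin.zero
    σ-last = Finₚ.toℕ-injective πF-cox-last

    Y-entry : ∀ i t → (β ⊗ (word cox ⊗ β′)) i t ≈ ΣF (λ a → β i a * β′ (σ a) t)
    Y-entry i t = ΣF-cong {f = λ a → β i a * (word cox ⊗ β′) a t} {g = λ a → β i a * β′ (σ a) t}
                          (λ a → *-congˡ (word-⊗ cox-letters β′ a t))

    β′[0,s]≈0 : β′ Fin.zero s ≈ 0#
    β′[0,s]≈0 = Unit-cancelˡ (β-diag last) (begin
      β last last * β′ Fin.zero s       ≡⟨ ≡.cong (λ r → β last last * β′ r s) σ-last ⟨
      β last last * β′ (σ last) s       ≈⟨ ΣF-single {f = λ a → β last a * β′ (σ a) s} last off ⟨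
      ΣF (λ a → β last a * β′ (σ a) s)  ≈⟨ Y-entry last s ⟨
      (β ⊗ (word cox ⊗ β′)) last s      ≈⟨ Y[last,s]≈0 ⟩
      0#                                ∎)
      where
      off : ∀ a → a ≢ last → β last a * β′ (σ a) s ≈ 0#
      off a a≢last = annihilˡ (β-ut last a (≡.subst (toℕ a <_) (≡.sym toℕ-last) (below-last a≢last)))

    witness : ∀ t → β′ Fin.zero t ≈ 0# →
              Σ[ p ∈ Fin (suc m) ] (suc (toℕ p) ≡ toℕ t × ¬ ((β ⊗ (word cox ⊗ β′)) p t ≈ 0#))
    witness Fin.zero       β′[0,0]≈0 = contradiction β′[0,0]≈0 (Unit⇒≉0 (β′-diag Fin.zero))
    witness (Fin.suc t′) β′[0,t]≈0 =
      p , ≡.cong suc (Finₚ.toℕ-inject₁ t′) ,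
      λ Y[p,t]≈0 → Unit⇒≉0 (Unit-* (β-diag p) (β′-diag t)) (trans (sym Y[p,t]≈diag) Y[p,t]≈0)
      where
      t p : Fin (suc m)
      t = Fin.suc t′
      p = inject₁ t′
      p<m : toℕ p < m
      p<m = ≡.subst (_< m) (≡.sym (Finₚ.toℕ-inject₁ t′)) (Finₚ.toℕ<n t′)
      σp≡t : σ p ≡ t
      σp≡t = Finₚ.toℕ-injective (≡.trans (πF-cox-below p p<m) (≡.cong suc (Finₚ.toℕ-inject₁ t′)))
      off : ∀ a → a ≢ p → β p a * β′ (σ a) t ≈ 0#
      off a a≢p with ≢⇒<⊎> a≢p
      ... | inj₁ a<p = annihilˡ (β-ut p a a<p)
      ... | inj₂ p<a with a Fin.≟ last
      ...   | yes ≡.refl = annihilʳ (≡.subst (λ r → β′ r t ≈ 0#) (≡.sym σ-last) β′[0,t]≈0)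
      ...   | no  a≢last = annihilʳ (β′-ut (σ a) t
                (≡.subst (toℕ t <_) (≡.sym (πF-cox-below a (below-last a≢last)))
                  (≡.subst (λ q → suc q < suc (toℕ a)) (Finₚ.toℕ-inject₁ t′) (s≤s p<a))))
      Y[p,t]≈diag : (β ⊗ (word cox ⊗ β′)) p t ≈ β p p * β′ t t
      Y[p,t]≈diag = begin
        (β ⊗ (word cox ⊗ β′)) p t         ≈⟨ Y-entry p t ⟩
        ΣF (λ a → β p a * β′ (σ a) t)     ≈⟨ ΣF-single {f = λ a → β p a * β′ (σ a) t} p off ⟩
        β p p * β′ (σ p) t                ≡⟨ ≡.cong (λ r → β p p * β′ r t) σp≡t ⟩
        β p p * β′ t t                    ∎

  -- A conjugate Z i l = Y (σ i) (σ l) of a matrix with superdiagonal witnesses,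
  -- by an onto σ fixing `last`, is not in P_k for 1 ≤ k ≤ m: each column l < k
  -- yields a column l′ < k with σ l′ < σ l, an infinite descent.
  conjugate-not-parabolic : ∀ {k Y Z} (σ σ⁻ : Fin (suc m) → Fin (suc m)) →
    (∀ x → σ (σ⁻ x) ≡ x) → σ last ≡ last → (∀ i l → Z i l ≈ Y (σ i) (σ l)) →
    SuperdiagonalWitness Y → 1 ≤ k → k ≤ m → ¬ Parabolic k Z
  conjugate-not-parabolic {k} {Y} {Z} σ σ⁻ σσ⁻≡id σ-last Z≈Yσσ Y-witness 1≤k k≤m Z∈P =
    descent∧wf⇒empty descent (On.wellFounded (λ l → toℕ (σ l)) <-wellFounded) Fin.zero 1≤k
    where
    k≤last : k ≤ toℕ last
    k≤last = ≡.subst (k ≤_) (≡.sym toℕ-last) k≤m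

    descent : ∀ {l} → toℕ l < k → ∃[ l′ ] (toℕ (σ l′) < toℕ (σ l) × toℕ l′ < k)
    descent {l} l<k with Y-witness (σ l) bottom≈0
      where
      bottom≈0 : Y last (σ l) ≈ 0#
      bottom≈0 = begin
        Y last (σ l)      ≡⟨ ≡.cong (λ r → Y r (σ l)) σ-last ⟨
        Y (σ last) (σ l)  ≈⟨ Z≈Yσσ last l ⟨
        Z last l          ≈⟨ Z∈P last l l<k k≤last ⟩
        0#                ∎
    ... | p , 1+p≡σl , Y[p,σl]≉0 = σ⁻ p , σσ⁻p<σl , σ⁻p<k
      where
      σσ⁻p<σl : toℕ (σ (σ⁻ p)) < toℕ (σ l)
      σσ⁻p<σl = ≡.subst (λ q → toℕ q < toℕ (σ l)) (≡.sym (σσ⁻≡id p))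
                  (≡.subst (toℕ p <_) 1+p≡σl (ℕₚ.n<1+n (toℕ p)))
      σ⁻p<k : toℕ (σ⁻ p) < k
      σ⁻p<k with toℕ (σ⁻ p) <? k
      ... | yes σ⁻p<k = σ⁻p<k
      ... | no  σ⁻p≮k = contradiction (begin
        Y p (σ l)            ≡⟨ ≡.cong (λ r → Y r (σ l)) (σσ⁻≡id p) ⟨
        Y (σ (σ⁻ p)) (σ l)   ≈⟨ Z≈Yσσ (σ⁻ p) l ⟨
        Z (σ⁻ p) l           ≈⟨ Z∈P (σ⁻ p) l l<k (ℕₚ.≮⇒≥ σ⁻p≮k) ⟩
        0#                   ∎) Y[p,σl]≉0

lemma19 : ∀ {c ℓ : Level} (F : Field c ℓ) (n : ℕ) → 3 ≤ n → (k : ℕ) → 1 ≤ k → k ≤ n ∸ 2 →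
            (w w' : List ℕ) → Matrices.WordIn F n (n ∸ 1) w → Matrices.WordIn F n k w' →
            (M : Matrices.Mat F n) →
            Matrices.InCell³ F n (Matrices.word F n w) (Matrices.word F n (Matrices.cox F n))
              (Matrices.word F n (Matrices.inv F n w)) M →
            Matrices.InCell F n (Matrices.word F n w') M → ⊥
lemma19 F (suc m) _ k 1≤k k≤m-1 w w′ w∈W w′∈W M M∈C³ M∈C′ =
  contradiction-from (conjugate-in-parabolic {U = word w} {V = word cox} {X = word (reverse w)} M∈C³
                        (Parabolic-cell w′-avoids-k M∈C′))
  where
  open Matrices F (suc m)
  open MatrixAlgebra F (suc m)
  open Bruhat F m

  w-letters : All Letter w
  w-letters = All.map (λ (_ , j≤m , _) → j≤m) w∈W

  w-below-m : All (_< m) w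
  w-below-m = All.map (λ (_ , j≤m , j≢m) → ℕₚ.≤∧≢⇒< j≤m j≢m) w∈W

  w′-avoids-k : All (_≢ k) w′
  w′-avoids-k = All.map (λ (_ , _ , j≢k) → j≢k) w′∈W

  contradiction-from : ∃[ β ] ∃[ β′ ] (UnitUT β × UnitUT β′ ×
                         Parabolic k (word w ⊗ ((β ⊗ (word cox ⊗ β′)) ⊗ word (reverse w)))) → ⊥
  contradiction-from (β , β′ , β∈B , β′∈B , Z∈P) =
    conjugate-not-parabolic (πF w) (πF⁻¹ w) (πF-πF⁻¹ w-letters) (πF-fix-last w-letters w-below-m)
      (conjugate-entry w-letters (β ⊗ (word cox ⊗ β′))) (coxeter-witness β∈B β′∈B)
      1≤k (ℕₚ.≤-trans k≤m-1 (ℕₚ.m∸n≤m m 1)) Z∈P
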